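{- Let $I$ be a nonempty set and $P$ a finite subset of $I$, and let $\{\beta_1,\dots,\beta_{q+1}\}$ be the $P$-adequate partition of $I$. Then each predicate $\beta_j$ ($1\le j\le q+1$) belongs to every Henkin–Asser structure with individual domain $I$ (i.e. $\beta_j\in J_1$ for every such structure $(J_k)_{k\ge0}$). Moreover, ${\rm sym}_{\mathfrak G}(\beta_j)\supseteq\mathfrak G(P)$ for every subgroup $\mathfrak G$ of the group $\mathfrak G^I_1$ of all permutations of $I$ and every $j$.
   Context: For a nonempty set $I$, ${\rm pred}_k(I)$ is the set of maps $\alpha:I^k\to\{true,false\}$, identified with their extensions $\widetilde\alpha\subseteq I^k$. A predicate structure with individual domain $I$ is $(J_k)_{k\ge0}$ with $J_0=I$, $\emptyset\ne J_k\subseteq{\rm pred}_k(I)$, interpreting second-order logic with $k$-ary predicate quantifiers ranging over $J_k$ (Henkin semantics). It is a Henkin–Asser structure if for every second-order formula $G$, every tuple $\mathbf x$ of $k$ distinct individual variables and every assignment $f$, the predicate $\xi\mapsto$ (truth value of $G$ under $f$ modified to send $\mathbf x$ to $\xi$) belongs to $J_k$. If $P=\{\nu_1,\dots,\nu_q\}$ with $q=|P|$ (and $q=0$ if $P=\emptyset$), the $P$-adequate partition of $I$ consists of the unary predicates $\beta_j$ with $\widetilde{\beta_j}=\{\nu_j\}$ for $1\le j\le q$ and $\widetilde{\beta_{q+1}}=I\setminus P$. For a permutation $\pi$ of $I$, $\alpha^\pi$ has extension $\{\pi(\xi):\xi\in\widetilde\alpha\}$ (componentwise action); for a subgroup $\mathfrak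 G$, $\mathfrak G(P)=\{\pi\in\mathfrak G:\pi(p)=p\ \forall p\in P\}$ and ${\rm sym}_{\mathfrak G}(\alpha)=\{\pi\in\mathfrak G:\alpha^\pi=\alpha\}$. -}

module Defs where

open import Data.Nat using (ℕ; zero; suc; _≟_)
open import Data.Fin using (Fin; zero; suc)
open import Data.Bool using (Bool; true; false)
open import Data.Product using (Σ; ∃; _×_; _,_; proj₁)
open import Data.Sum using (_⊎_)
open import Data.Maybe using (Maybe; just; nothing)
import Data.Maybe
open import Data.Empty using (⊥)
open import Relation.Nullary using (¬_; yes; no)
open import Relation.Binary.PropositionalEquality using (_≡_; refl)
open import Function.Bundles using (_↔_; Inverse; _⇔_)
open import Function.Definitions using (Injective)
open import Function.Construct.Identity using (↔-id)
open import Function.Construct.Symmetry using (↔-sym)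
open import Function.Construct.Composition using (_↔-∘_)

-- Predicates.  Pr I k is pred_{k+1}(I): maps I^{k+1} → {true,false}
-- (tuples are maps Fin (suc k) → I).  Indexing is shifted by one so that
-- only arities ≥ 1 occur (the paper sets J_0 = I).

Pr : Set → ℕ → Set
Pr I k = (Fin (suc k) → I) → Bool

record PredStructure (I : Set) : Set₁ where
  field
    J        : (k : ℕ) → Pr I k → Set
    nonempty : (k : ℕ) → ∃ λ α → J k α
open PredStructure public

-- Syntax of second-order logic (with equality).
-- Individual variables are indexed by ℕ; predicate variables of arity
-- suc k are indexed by (k , n).

data Form : Set where
  _≐_  : ℕ → ℕ → Form
  app  : (k n : ℕ) → (Fin (suc k) → ℕ) → Form
  ~_   : Form → Form
  _∧'_ : Form → Form → Form
  _∨'_ : Form → Form → Form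
  _⇒'_ : Form → Form → Form
  ∀i   : ℕ → Form → Form
  ∃i   : ℕ → Form → Form
  ∀p   : (k n : ℕ) → Form → Form
  ∃p   : (k n : ℕ) → Form → Form

-- Assignments (Henkin semantics: predicate variables range over J).

record Assign {I : Set} (S : PredStructure I) : Set where
  field
    ind  : ℕ → I
    prd  : (k n : ℕ) → Σ (Pr I k) (J S k)
open Assign public

updI : {I : Set} → (ℕ → I) → ℕ → I → ℕ → I
updI g x v n with n ≟ x
... | yes _ = v
... | no  _ = g n

updTuple : {I : Set} (k : ℕ) → (Fin k → ℕ) → (Fin k → I) → (ℕ → I) → ℕ → I
updTuple zero    x ξ g = g
updTuple (suc k) x ξ g = updI (updTuple k (λ i → x (suc i)) (λ i → ξ (suc i)) g) (x zero) (ξ zero)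

updP : {I : Set} {S : PredStructure I} →
       ((k n : ℕ) → Σ (Pr I k) (J S k)) →
       (k n : ℕ) → Σ (Pr I k) (J S k) →
       (k' n' : ℕ) → Σ (Pr I k') (J S k')
updP h k n a k' n' with k' ≟ k | n' ≟ n
... | yes refl | yes _ = a
... | _        | _     = h k' n'

withInd : {I : Set} {S : PredStructure I} → Assign S → (ℕ → I) → Assign S
withInd f g = record { ind = g ; prd = prd f }

withPrd : {I : Set} {S : PredStructure I} → Assign S → (k n : ℕ) → Σ (Pr I k) (J S k) → Assign S
withPrd {S = S} f k n a = record { ind = ind f ; prd = updP {S = S} (prd f) k n a }

Sat : {I : Set} (S : PredStructure I) → Assign S → Form → Set
Sat S f (m ≐ n)      = ind f m ≡ ind f n
Sat S f (app k n xs) = proj₁ (prd f k n) (λ i → ind f (xs i)) ≡ true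
Sat S f (~ G)        = ¬ Sat S f G
Sat S f (G ∧' H)     = Sat S f G × Sat S f H
Sat S f (G ∨' H)     = Sat S f G ⊎ Sat S f H
Sat S f (G ⇒' H)     = Sat S f G → Sat S f H
Sat {I} S f (∀i x G) = (v : I) → Sat S (withInd f (updI (ind f) x v)) G
Sat S f (∃i x G)     = ∃ λ v → Sat S (withInd f (updI (ind f) x v)) G
Sat S f (∀p k n G)   = (α : Pr _ k) (jα : J S k α) → Sat S (withPrd f k n (α , jα)) G
Sat S f (∃p k n G)   = ∃ λ (α : Pr _ k) → Σ (J S k α) λ jα → Sat S (withPrd f k n (α , jα)) G

IsHenkinAsser : {I : Set} → PredStructure I → Set
IsHenkinAsser {I} S =
  (k : ℕ) (G : Form) (x : Fin (suc k) → ℕ) → Injective _≡_ _≡_ x →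
  (f : Assign S) →
  ∃ λ α → J S k α ×
    ((ξ : Fin (suc k) → I) → (α ξ ≡ true) ⇔ Sat S (withInd f (updTuple (suc k) x ξ (ind f))) G)

-- The P-adequate partition, given by extensions (subsets of I).
-- P = {ν_0,…,ν_{q-1}} with ν injective (so q = |P|);
-- block j = inject i has extension {ν_i}, the last block (j = q) has I ∖ P.

_∈P_ : {I : Set} {q : ℕ} → I → (Fin q → I) → Set
ξ ∈P ν = ∃ λ i → ξ ≡ ν i

-- index j : Fin (suc q) (paper's j+1); j < q ↦ just j, j = q ↦ nothing
blockIndex : {q : ℕ} → Fin (suc q) → Maybe (Fin q)
blockIndex {zero}  zero    = nothing
blockIndex {suc q} zero    = just zero
blockIndex {suc q} (suc j) = Data.Maybe.map suc (blockIndex j)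

adequateExt : {I : Set} {q : ℕ} → (Fin q → I) → Fin (suc q) → I → Set
adequateExt ν j ξ with blockIndex j
... | just i  = ξ ≡ ν i
... | nothing = ¬ (ξ ∈P ν)

Perm : Set → Set
Perm I = I ↔ I

-- extension of α^π, where E is the extension of α (unary case)
actExt : {I : Set} → Perm I → (I → Set) → I → Set
actExt π E y = ∃ λ ξ → E ξ × Inverse.to π ξ ≡ y

Fixes : {I : Set} → Perm I → (I → Set) → Set
Fixes π E = (y : _) → actExt π E y ⇔ E y

record IsSubgroup {I : Set} (𝔊 : Perm I → Set) : Set where
  field
    has-id  : 𝔊 (↔-id I)
    has-∘   : ∀ {π σ} → 𝔊 π → 𝔊 σ → 𝔊 (π ↔-∘ σ)
    has-inv : ∀ {π} → 𝔊 π → 𝔊 (↔-sym π)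

-- Each block of the P-adequate partition is first-order definable from the points of P:
-- {ν_i} by x₀ = x₁ with x₁ ↦ ν_i, and I ∖ P by ⋀_i ¬ (x₀ = x_{i+1}) with x_{i+1} ↦ ν_i.
-- A Henkin–Asser structure contains every definable unary predicate. A permutation fixing
-- P pointwise maps each of these sets onto itself, since it maps ξ into P (resp. onto ν_i)
-- exactly when ξ is in P (resp. equals ν_i).
module Submission where

open import Defs
open import Data.Nat using (ℕ; zero; suc)
open import Data.Fin using (Fin; toℕ) renaming (zero to fzero; suc to fsuc)
open import Data.Bool using (true)
open import Data.Product using (∃; _×_; _,_)
open import Data.Maybe using (just; nothing)
open import Relation.Nullary using (¬_)
open import Relation.Binary.PropositionalEquality using (_≡_; refl; sym; trans; cong; subst; module ≡-Reasoning)
open import Function.Bundles using (Inverse; _⇔_; mk⇔; Equivalence)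
open import Function.Definitions using (Injective)
open import Function.Construct.Identity using (⇔-id)
open import Function.Construct.Composition using (_⇔-∘_)
open import Function.Related.TypeIsomorphisms using (¬-cong-⇔)

private
  variable
    I : Set
    q : ℕ

assignment : (S : PredStructure I) → (ℕ → I) → Assign S
assignment S g = record { ind = g ; prd = λ k n → nonempty S k }

HenkinAsser-definable : {S : PredStructure I} → IsHenkinAsser S →
  (G : Form) (g : ℕ → I) (E : I → Set) →
  ((ξ : I) → Sat S (assignment S (updI g 0 ξ)) G ⇔ E ξ) →
  ∃ λ α → J S 0 α × ((ξ : I) → (α (λ _ → ξ) ≡ true) ⇔ E ξ)
HenkinAsser-definable {S = S} HA G g E G⇔E
  with HA 0 G (λ _ → 0) (λ { {fzero} {fzero} _ → refl }) (assignment S g)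
... | α , α∈J , α⇔G = α , α∈J , λ ξ → G⇔E ξ ⇔-∘ α⇔G (λ _ → ξ)

⋀ : (Fin q → Form) → Form
⋀ {zero}  Gs = 0 ≐ 0
⋀ {suc q} Gs = Gs fzero ∧' ⋀ (λ i → Gs (fsuc i))

Sat-⋀ : (S : PredStructure I) (f : Assign S) (Gs : Fin q → Form) →
  Sat S f (⋀ Gs) ⇔ ((i : Fin q) → Sat S f (Gs i))
Sat-⋀ {q = zero}  S f Gs = mk⇔ (λ _ ()) (λ _ → refl)
Sat-⋀ {q = suc q} S f Gs = mk⇔
  (λ { (G₀ , Gs₊) fzero → G₀ ; (G₀ , Gs₊) (fsuc i) → Equivalence.to IH Gs₊ i })
  (λ all → all fzero , Equivalence.from IH (λ i → all (fsuc i)))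
  where IH = Sat-⋀ S f (λ i → Gs (fsuc i))

avoidsFormula : ℕ → Form
avoidsFormula q = ⋀ {q} (λ i → ~ (0 ≐ suc (toℕ i)))

pointsAssignment : I → (Fin q → I) → ℕ → I
pointsAssignment {q = zero}  e ν n             = e
pointsAssignment {q = suc q} e ν zero          = e
pointsAssignment {q = suc q} e ν (suc zero)    = ν fzero
pointsAssignment {q = suc q} e ν (suc (suc n)) = pointsAssignment e (λ i → ν (fsuc i)) (suc n)

pointsAssignment-suc-toℕ : (e : I) (ν : Fin q → I) (i : Fin q) →
  pointsAssignment e ν (suc (toℕ i)) ≡ ν i
pointsAssignment-suc-toℕ e ν fzero    = refl
pointsAssignment-suc-toℕ e ν (fsuc i) = pointsAssignment-suc-toℕ e (λ i → ν (fsuc i)) i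

Sat-avoidsFormula : (S : PredStructure I) (e : I) (ν : Fin q → I) (ξ : I) →
  Sat S (assignment S (updI (pointsAssignment e ν) 0 ξ)) (avoidsFormula q)
    ⇔ (¬ (ξ ∈P ν))
Sat-avoidsFormula {q = q} S e ν ξ =
  mk⇔ (λ avoids (i , ξ≡νi) → avoids i (trans ξ≡νi (sym (value i))))
      (λ ξ∉P i ξ≡ → ξ∉P (i , trans ξ≡ (value i)))
  ⇔-∘ Sat-⋀ S _ (λ i → ~ (0 ≐ suc (toℕ i)))
  where
  value : (i : Fin q) → pointsAssignment e ν (suc (toℕ i)) ≡ ν i
  value = pointsAssignment-suc-toℕ e ν

adequateExt-∈J : I → (ν : Fin q → I) (j : Fin (suc q)) →
  (S : PredStructure I) → IsHenkinAsser S →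
  ∃ λ α → J S 0 α × ((ξ : I) → (α (λ _ → ξ) ≡ true) ⇔ adequateExt ν j ξ)
adequateExt-∈J {q = q} e ν j S HA with blockIndex j
... | just i  = HenkinAsser-definable HA (0 ≐ 1) (λ _ → ν i) _ (λ _ → ⇔-id _)
... | nothing = HenkinAsser-definable HA (avoidsFormula q) _ _ (Sat-avoidsFormula S e ν)

invariant⇒Fixes : (π : Perm I) (E : I → Set) →
  ((ξ : I) → E ξ ⇔ E (Inverse.to π ξ)) → Fixes π E
invariant⇒Fixes π E E⇔Eπ y = mk⇔
  (λ { (ξ , Eξ , refl) → Equivalence.to (E⇔Eπ ξ) Eξ })
  (λ Ey → from y , Equivalence.from (E⇔Eπ (from y)) (subst E (sym (strictlyInverseˡ y)) Ey)
                 , strictlyInverseˡ y)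
  where open Inverse π

≡-fixedPoint⇔ : (π : Perm I) {p : I} → Inverse.to π p ≡ p →
  (ξ : I) → (ξ ≡ p) ⇔ (Inverse.to π ξ ≡ p)
≡-fixedPoint⇔ π {p} πp≡p ξ = mk⇔
  (λ { refl → πp≡p })
  (λ πξ≡p → begin
     ξ             ≡⟨ strictlyInverseʳ ξ ⟨
     from (to ξ)   ≡⟨ cong from (trans πξ≡p (sym πp≡p)) ⟩
     from (to p)   ≡⟨ strictlyInverseʳ p ⟩
     p             ∎)
  where
  open Inverse π
  open ≡-Reasoning

∈P-invariant : (π : Perm I) (ν : Fin q → I) → ((i : Fin q) → Inverse.to π (ν i) ≡ ν i) →
  (ξ : I) → (ξ ∈P ν) ⇔ (Inverse.to π ξ ∈P ν)
∈P-invariant π ν fixes ξ = mk⇔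
  (λ { (i , ξ≡νi) → i , Equivalence.to   (≡-fixedPoint⇔ π (fixes i) ξ) ξ≡νi })
  (λ { (i , πξ≡νi) → i , Equivalence.from (≡-fixedPoint⇔ π (fixes i) ξ) πξ≡νi })

adequateExt-invariant : (π : Perm I) (ν : Fin q → I) → ((i : Fin q) → Inverse.to π (ν i) ≡ ν i) →
  (j : Fin (suc q)) (ξ : I) → adequateExt ν j ξ ⇔ adequateExt ν j (Inverse.to π ξ)
adequateExt-invariant π ν fixes j ξ with blockIndex j
... | just i  = ≡-fixedPoint⇔ π (fixes i) ξ
... | nothing = ¬-cong-⇔ (∈P-invariant π ν fixes ξ)

lemma4p7 : {I : Set} → I → (q : ℕ) (ν : Fin q → I) → Injective _≡_ _≡_ ν →
    (j : Fin (suc q)) →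
    ((S : PredStructure I) → IsHenkinAsser S →
      ∃ λ α → J S 0 α × ((ξ : I) → (α (λ _ → ξ) ≡ true) ⇔ adequateExt ν j ξ))
    × ((𝔊 : Perm I → Set) → IsSubgroup 𝔊 →
      (π : Perm I) → 𝔊 π → ((i : Fin q) → Inverse.to π (ν i) ≡ ν i) →
      Fixes π (adequateExt ν j))
lemma4p7 e q ν _ j =
  adequateExt-∈J e ν j ,
  λ _ _ π _ fixes → invariant⇒Fixes π (adequateExt ν j) (adequateExt-invariant π ν fixes j)
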